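{- Let $G,H$ be short combinatorial games with $G\triangleq H$. Then for every short game $K$, $G\mathbin{:}K = H\mathbin{:}K$.
   Context: Games are short normal-play combinatorial games, written $G\cong\{L(G)\mid R(G)\}$ ($\cong$ = identical literal form). Disjunctive sum $G+H\cong\{G^L+H,G+H^L\mid G^R+H,G+H^R\}$, negation $-G\cong\{ -R(G)\mid-L(G)\}$, and $G=H$ means the second player wins $G+(-H)$. The ordinal sum is $G\mathbin{:}H\cong\{L(G),\,G\mathbin{:}H^L\mid R(G),\,G\mathbin{:}H^R\}$ (ranging over all $H^L\in L(H)$, $H^R\in R(H)$). $G\triangleq H$ (equivalence modulo domination) means that in $G+(-H)$, for every first move by either player in either summand, the other player has a winning response made in the other summand. -}

module Defs where

open import Data.List using (List; []; _∷_; _++_)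
open import Data.List.Relation.Unary.All using (All)
open import Data.List.Relation.Unary.Any using (Any)
open import Data.Product using (_×_)

-- Short games as finite trees with finite lists of Left / Right options.
-- Two games are literally identical (≅) iff they are equal as terms.
data Game : Set where
  ⟨_∣_⟩ : List Game → List Game → Game

leftOpts : Game → List Game
leftOpts ⟨ L ∣ R ⟩ = L

rightOpts : Game → List Game
rightOpts ⟨ L ∣ R ⟩ = R

mutual
  neg : Game → Game
  neg ⟨ L ∣ R ⟩ = ⟨ negs R ∣ negs L ⟩

  negs : List Game → List Game
  negs [] = []
  negs (g ∷ gs) = neg g ∷ negs gs

mutual
  infixl 6 _⊕_
  _⊕_ : Game → Game → Game
  G@(⟨ GL ∣ GR ⟩) ⊕ H@(⟨ HL ∣ HR ⟩) =
    ⟨ addˡ GL H ++ addʳ G HL ∣ addˡ GR H ++ addʳ G HR ⟩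

  addˡ : List Game → Game → List Game
  addˡ [] H = []
  addˡ (g ∷ gs) H = (g ⊕ H) ∷ addˡ gs H

  addʳ : Game → List Game → List Game
  addʳ G [] = []
  addʳ G (h ∷ hs) = (G ⊕ h) ∷ addʳ G hs

mutual
  infixl 7 _∶_
  _∶_ : Game → Game → Game
  G ∶ ⟨ HL ∣ HR ⟩ = ⟨ leftOpts G ++ ords G HL ∣ rightOpts G ++ ords G HR ⟩

  ords : Game → List Game → List Game
  ords G [] = []
  ords G (h ∷ hs) = (G ∶ h) ∷ ords G hs

-- Normal play outcomes (the player unable to move loses).
-- LWin₁ G : Left wins G moving first;  LWin₂ G : Left wins G moving second.
-- RWin₁ / RWin₂ similarly for Right.
mutual
  data LWin₁ : Game → Set where
    lwin₁ : ∀ {G} → Any LWin₂ (leftOpts G) → LWin₁ G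

  data LWin₂ : Game → Set where
    lwin₂ : ∀ {G} → All LWin₁ (rightOpts G) → LWin₂ G

mutual
  data RWin₁ : Game → Set where
    rwin₁ : ∀ {G} → Any RWin₂ (rightOpts G) → RWin₁ G

  data RWin₂ : Game → Set where
    rwin₂ : ∀ {G} → All RWin₁ (leftOpts G) → RWin₂ G

SecondWins : Game → Set
SecondWins G = LWin₂ G × RWin₂ G

infix 4 _≡ᵍ_
_≡ᵍ_ : Game → Game → Set
G ≡ᵍ H = SecondWins (G ⊕ neg H)

-- Equivalence modulo domination, G ≜ H: in G + (-H), for every first move
-- by either player in either summand, the other player has a winning
-- response (i.e. afterwards wins moving second) made in the other summand.
infix 4 _≜_
_≜_ : Game → Game → Set
G ≜ H =
    All (λ gl → Any (λ nh → RWin₂ (gl ⊕ nh)) (rightOpts (neg H))) (leftOpts G)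
  ×
    All (λ nh → Any (λ gr → RWin₂ (gr ⊕ nh)) (rightOpts G)) (leftOpts (neg H))
  ×
    All (λ gr → Any (λ nh → LWin₂ (gr ⊕ nh)) (leftOpts (neg H))) (rightOpts G)
  ×
    All (λ nh → Any (λ gl → LWin₂ (gl ⊕ nh)) (leftOpts G)) (rightOpts (neg H))

{-# OPTIONS --safe #-}
module Submission where

-- The mirror strategy of G ≜ H extends to G : K versus H : K by induction on K.
-- A Right move in G : K either goes to G^R, answered by Left as in G ≜ H inside
-- -(H : K), whose options contain those of -H; or it goes to G : K^R, answered by
-- the copy -(H : K^R), after which the induction hypothesis applies.  Moves in
-- -(H : K) and the moves of Right are symmetric.

open import Defs
open import Data.List using (List; []; _∷_; _++_; map)
open import Data.List.Properties using (map-++; map-∘)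
open import Data.List.Relation.Unary.All as All using (All; []; _∷_)
open import Data.List.Relation.Unary.Any as Any using (Any)
import Data.List.Relation.Unary.All.Properties as All
import Data.List.Relation.Unary.Any.Properties as Any
open import Data.Product using (_,_)
open import Function using (_∘_; flip)
open import Relation.Binary.PropositionalEquality
  using (_≡_; refl; sym; cong; cong₂; subst; subst₂; module ≡-Reasoning)

game-ind : (P : Game → Set) →
           (∀ {L R} → All P L → All P R → P ⟨ L ∣ R ⟩) → ∀ G → P G
game-ind P step ⟨ L ∣ R ⟩ = step (all L) (all R)
  where
  all : ∀ xs → All P xs
  all []       = []
  all (x ∷ xs) = game-ind P step x ∷ all xs

addˡ-map : ∀ xs B → addˡ xs B ≡ map (_⊕ B) xs
addˡ-map []       B = refl
addˡ-map (x ∷ xs) B = cong (x ⊕ B ∷_) (addˡ-map xs B)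

addʳ-map : ∀ A ys → addʳ A ys ≡ map (A ⊕_) ys
addʳ-map A []       = refl
addʳ-map A (y ∷ ys) = cong (A ⊕ y ∷_) (addʳ-map A ys)

negs-map : ∀ xs → negs xs ≡ map neg xs
negs-map []       = refl
negs-map (x ∷ xs) = cong (neg x ∷_) (negs-map xs)

ords-map : ∀ G ks → ords G ks ≡ map (G ∶_) ks
ords-map G []       = refl
ords-map G (k ∷ ks) = cong (G ∶ k ∷_) (ords-map G ks)

leftOpts-⊕ : ∀ A B → leftOpts (A ⊕ B) ≡ map (_⊕ B) (leftOpts A) ++ map (A ⊕_) (leftOpts B)
leftOpts-⊕ A@(⟨ AL ∣ _ ⟩) B@(⟨ BL ∣ _ ⟩) = cong₂ _++_ (addˡ-map AL B) (addʳ-map A BL)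

rightOpts-⊕ : ∀ A B → rightOpts (A ⊕ B) ≡ map (_⊕ B) (rightOpts A) ++ map (A ⊕_) (rightOpts B)
rightOpts-⊕ A@(⟨ _ ∣ AR ⟩) B@(⟨ _ ∣ BR ⟩) = cong₂ _++_ (addˡ-map AR B) (addʳ-map A BR)

leftOpts-∶ : ∀ G K → leftOpts (G ∶ K) ≡ leftOpts G ++ map (G ∶_) (leftOpts K)
leftOpts-∶ G ⟨ KL ∣ _ ⟩ = cong (leftOpts G ++_) (ords-map G KL)

rightOpts-∶ : ∀ G K → rightOpts (G ∶ K) ≡ rightOpts G ++ map (G ∶_) (rightOpts K)
rightOpts-∶ G ⟨ _ ∣ KR ⟩ = cong (rightOpts G ++_) (ords-map G KR)

leftOpts-neg : ∀ G → leftOpts (neg G) ≡ map neg (rightOpts G)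
leftOpts-neg ⟨ _ ∣ R ⟩ = negs-map R

rightOpts-neg : ∀ G → rightOpts (neg G) ≡ map neg (leftOpts G)
rightOpts-neg ⟨ L ∣ _ ⟩ = negs-map L

leftOpts-neg-∶ : ∀ H K →
  leftOpts (neg (H ∶ K)) ≡ leftOpts (neg H) ++ map (neg ∘ (H ∶_)) (rightOpts K)
leftOpts-neg-∶ H K = begin
  leftOpts (neg (H ∶ K))                                        ≡⟨ leftOpts-neg (H ∶ K) ⟩
  map neg (rightOpts (H ∶ K))                                   ≡⟨ cong (map neg) (rightOpts-∶ H K) ⟩
  map neg (rightOpts H ++ map (H ∶_) (rightOpts K))             ≡⟨ map-++ neg (rightOpts H) _ ⟩
  map neg (rightOpts H) ++ map neg (map (H ∶_) (rightOpts K))   ≡⟨ cong₂ _++_ (sym (leftOpts-neg H)) (sym (map-∘ (rightOpts K))) ⟩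
  leftOpts (neg H) ++ map (neg ∘ (H ∶_)) (rightOpts K)          ∎
  where open ≡-Reasoning

rightOpts-neg-∶ : ∀ H K →
  rightOpts (neg (H ∶ K)) ≡ rightOpts (neg H) ++ map (neg ∘ (H ∶_)) (leftOpts K)
rightOpts-neg-∶ H K = begin
  rightOpts (neg (H ∶ K))                                       ≡⟨ rightOpts-neg (H ∶ K) ⟩
  map neg (leftOpts (H ∶ K))                                    ≡⟨ cong (map neg) (leftOpts-∶ H K) ⟩
  map neg (leftOpts H ++ map (H ∶_) (leftOpts K))               ≡⟨ map-++ neg (leftOpts H) _ ⟩
  map neg (leftOpts H) ++ map neg (map (H ∶_) (leftOpts K))     ≡⟨ cong₂ _++_ (sym (rightOpts-neg H)) (sym (map-∘ (leftOpts K))) ⟩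
  rightOpts (neg H) ++ map (neg ∘ (H ∶_)) (leftOpts K)          ∎
  where open ≡-Reasoning

Answers : (Game → Game → Set) → List Game → List Game → Set
Answers W xs ys = All (λ x → Any (W x) ys) xs

answers-++-map : ∀ {W xs ys ks} (f g : Game → Game) → Answers W xs ys →
                 All (λ k → W (f k) (g k)) ks →
                 Answers W (xs ++ map f ks) (ys ++ map g ks)
answers-++-map {W} {ys = ys} {ks} f g answers diagonal =
  All.++⁺ (All.map Any.++⁺ˡ answers) (All.map⁺ (All.tabulate answer-by-copy))
  where
  answer-by-copy : ∀ {k} → Any (k ≡_) ks → Any (W (f k)) (ys ++ map g ks)
  answer-by-copy k∈ = Any.++⁺ʳ ys (Any.map⁺ (Any.map (λ { refl → All.lookup diagonal k∈ }) k∈))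

LWin₁-⊕ˡ : ∀ A B → Any (λ a → LWin₂ (a ⊕ B)) (leftOpts A) → LWin₁ (A ⊕ B)
LWin₁-⊕ˡ A B p = lwin₁ (subst (Any LWin₂) (sym (leftOpts-⊕ A B)) (Any.++⁺ˡ (Any.map⁺ p)))

LWin₁-⊕ʳ : ∀ A B → Any (λ b → LWin₂ (A ⊕ b)) (leftOpts B) → LWin₁ (A ⊕ B)
LWin₁-⊕ʳ A B p = lwin₁ (subst (Any LWin₂) (sym (leftOpts-⊕ A B)) (Any.++⁺ʳ _ (Any.map⁺ p)))

RWin₁-⊕ˡ : ∀ A B → Any (λ a → RWin₂ (a ⊕ B)) (rightOpts A) → RWin₁ (A ⊕ B)
RWin₁-⊕ˡ A B p = rwin₁ (subst (Any RWin₂) (sym (rightOpts-⊕ A B)) (Any.++⁺ˡ (Any.map⁺ p)))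

RWin₁-⊕ʳ : ∀ A B → Any (λ b → RWin₂ (A ⊕ b)) (rightOpts B) → RWin₁ (A ⊕ B)
RWin₁-⊕ʳ A B p = rwin₁ (subst (Any RWin₂) (sym (rightOpts-⊕ A B)) (Any.++⁺ʳ _ (Any.map⁺ p)))

LWin₂-⊕ : ∀ A B →
  Answers (λ a b → LWin₂ (a ⊕ b)) (rightOpts A) (leftOpts B) →
  Answers (λ b a → LWin₂ (a ⊕ b)) (rightOpts B) (leftOpts A) →
  LWin₂ (A ⊕ B)
LWin₂-⊕ A B inB inA = lwin₂ (subst (All LWin₁) (sym (rightOpts-⊕ A B))
  (All.++⁺ (All.map⁺ (All.map (λ {a} → LWin₁-⊕ʳ a B) inB))
           (All.map⁺ (All.map (λ {b} → LWin₁-⊕ˡ A b) inA))))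

RWin₂-⊕ : ∀ A B →
  Answers (λ a b → RWin₂ (a ⊕ b)) (leftOpts A) (rightOpts B) →
  Answers (λ b a → RWin₂ (a ⊕ b)) (leftOpts B) (rightOpts A) →
  RWin₂ (A ⊕ B)
RWin₂-⊕ A B inB inA = rwin₂ (subst (All RWin₁) (sym (leftOpts-⊕ A B))
  (All.++⁺ (All.map⁺ (All.map (λ {a} → RWin₁-⊕ʳ a B) inB))
           (All.map⁺ (All.map (λ {b} → RWin₁-⊕ˡ A b) inA))))

≜⇒∶-≡ᵍ-step : ∀ {G H} → G ≜ H → ∀ {KL KR} →
  All (λ k → G ∶ k ≡ᵍ H ∶ k) KL → All (λ k → G ∶ k ≡ᵍ H ∶ k) KR →
  G ∶ ⟨ KL ∣ KR ⟩ ≡ᵍ H ∶ ⟨ KL ∣ KR ⟩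
≜⇒∶-≡ᵍ-step {G} {H} (Lin-G , Lin-H , Rin-G , Rin-H) {KL} {KR} ihL ihR =
    LWin₂-⊕ (G ∶ K) (neg (H ∶ K))
      (subst₂ (Answers L⊕) (sym (rightOpts-∶ G K)) (sym (leftOpts-neg-∶ H K))
        (answers-++-map (G ∶_) (neg ∘ (H ∶_)) Rin-G (All.map (λ (l , _) → l) ihR)))
      (subst₂ (Answers (flip L⊕)) (sym (rightOpts-neg-∶ H K)) (sym (leftOpts-∶ G K))
        (answers-++-map (neg ∘ (H ∶_)) (G ∶_) Rin-H (All.map (λ (l , _) → l) ihL)))
  , RWin₂-⊕ (G ∶ K) (neg (H ∶ K))
      (subst₂ (Answers R⊕) (sym (leftOpts-∶ G K)) (sym (rightOpts-neg-∶ H K))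
        (answers-++-map (G ∶_) (neg ∘ (H ∶_)) Lin-G (All.map (λ (_ , r) → r) ihL)))
      (subst₂ (Answers (flip R⊕)) (sym (leftOpts-neg-∶ H K)) (sym (rightOpts-∶ G K))
        (answers-++-map (neg ∘ (H ∶_)) (G ∶_) Lin-H (All.map (λ (_ , r) → r) ihR)))
  where
  K = ⟨ KL ∣ KR ⟩
  L⊕ R⊕ : Game → Game → Set
  L⊕ a b = LWin₂ (a ⊕ b)
  R⊕ a b = RWin₂ (a ⊕ b)

corollary2p3 : (G H : Game) → G ≜ H → (K : Game) → G ∶ K ≡ᵍ H ∶ K
corollary2p3 G H G≜H = game-ind (λ K → G ∶ K ≡ᵍ H ∶ K) (≜⇒∶-≡ᵍ-step G≜H)
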